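{- Let $G=(V,E)$ be a loopless multigraph and $D$, $D'$ two $k$-connected orientations of $G$. For every $v\in V$ with $\delta^+_D(v)>\delta^+_{D'}(v)$ there exists $u\in V$ such that $\delta^+_D(u)<\delta^+_{D'}(u)$ and $(v,u)$ is flippable in $D$.
   Context: $\delta^+_D(X)$ is the number of arcs of $D$ leaving $X\subseteq V$, $\delta^+_D(v)=\delta^+_D(\{v\})$. $D$ is $k$-connected if $\delta^+_D(X)\ge k$ for all $\emptyset\ne X\subsetneq V$. $\lambda_D(u,v)$ is the maximum number of pairwise arc-disjoint directed $u$–$v$ paths. In a $k$-connected $D$, a pair $(u,v)$ of distinct vertices is flippable if $\lambda_D(u,v)>k$. -}

module Defs where

open import Data.Nat using (ℕ; zero; suc; _+_; _≥_; _<_)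
open import Data.Fin using (Fin; _≟_)
open import Data.Bool using (Bool; true; false; if_then_else_; _∧_; not)
open import Data.List using (List; []; _∷_; map; allFin)
open import Data.Nat.ListAction using (sum)
open import Data.List.Membership.Propositional using (_∈_; _∉_)
open import Data.List.Relation.Unary.Unique.Propositional using (Unique)
open import Data.Product using (Σ; ∃; _×_; _,_; proj₁; proj₂; swap)
open import Relation.Binary.PropositionalEquality using (_≡_; _≢_)
open import Relation.Nullary.Decidable using (⌊_⌋)

-- A loopless multigraph on vertex set Fin n with m edges (parallel edges
-- allowed): edge e has endpoints ends e.
Loopless : ∀ {n m} → (Fin m → Fin n × Fin n) → Set
Loopless ends = ∀ e → proj₁ (ends e) ≢ proj₂ (ends e)

-- A digraph on Fin n with m arcs: arc a goes from proj₁ (D a) (tail) to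
-- proj₂ (D a) (head).
Digraph : ℕ → ℕ → Set
Digraph n m = Fin m → Fin n × Fin n

orient : ∀ {n m} → (Fin m → Fin n × Fin n) → (Fin m → Bool) → Digraph n m
orient ends o e = if o e then ends e else swap (ends e)

-- δ⁺_D(X): number of arcs with tail in X and head outside X (X ⊆ V as a
-- Boolean predicate).
outDegSet : ∀ {n m} → Digraph n m → (Fin n → Bool) → ℕ
outDegSet {m = m} D X =
  sum (map (λ a → if X (proj₁ (D a)) ∧ not (X (proj₂ (D a))) then 1 else 0) (allFin m))

outDeg : ∀ {n m} → Digraph n m → Fin n → ℕ
outDeg D v = outDegSet D (λ w → ⌊ w ≟ v ⌋)

KConnected : ∀ {n m} → ℕ → Digraph n m → Set
KConnected {n} k D =
  (X : Fin n → Bool) → (∃ λ x → X x ≡ true) → (∃ λ y → X y ≡ false) →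
  outDegSet D X ≥ k

data Walk {n m} (D : Digraph n m) : Fin n → Fin n → Set where
  []  : ∀ {u} → Walk D u u
  step : ∀ {u w} (a : Fin m) → proj₁ (D a) ≡ u → Walk D (proj₂ (D a)) w → Walk D u w

arcsOf : ∀ {n m} {D : Digraph n m} {u w} → Walk D u w → List (Fin m)
arcsOf [] = []
arcsOf (step a _ p) = a ∷ arcsOf p

vertsOf : ∀ {n m} {D : Digraph n m} {u w} → Walk D u w → List (Fin n)
vertsOf {u = u} [] = u ∷ []
vertsOf {u = u} (step a _ p) = u ∷ vertsOf p

Path : ∀ {n m} → Digraph n m → Fin n → Fin n → Set
Path D u w = Σ (Walk D u w) (λ p → Unique (vertsOf p))

-- There are r pairwise arc-disjoint directed u–w paths in D.
-- (λ_D(u,w) ≥ r, unfolding the definition of λ as a maximum.)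
DisjointPaths : ∀ {n m} → Digraph n m → Fin n → Fin n → ℕ → Set
DisjointPaths {m = m} D u w r =
  Σ (Fin r → Path D u w) λ P →
    ∀ i j → i ≢ j → ∀ (a : Fin m) →
      a ∈ arcsOf (proj₁ (P i)) → a ∉ arcsOf (proj₁ (P j))

-- In a k-connected D, (u,w) is flippable if u ≠ w and λ_D(u,w) > k,
-- i.e. there are k+1 pairwise arc-disjoint directed u–w paths.
Flippable : ∀ {n m} → ℕ → Digraph n m → Fin n → Fin n → Set
Flippable k D u w = u ≢ w × DisjointPaths D u w (suc k)

-- Lemma 7.  Let D and D′ be k-connected orientations of the same multigraph
-- and let δ⁺_D(v) > δ⁺_D′(v).  Call u deficient if δ⁺_D(u) < δ⁺_D′(u).  Then
-- some deficient u has λ_D(v,u) > k.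
--
-- Otherwise, by Menger's theorem, every deficient u is cut off from v
-- by a tight set: one containing v, missing u, and left by only k arcs of D.
-- Call S good if δ⁺_D(S) ≤ δ⁺_D′(S).  Tight sets are good (D′ is k-connected);
-- tight sets whose union is not V meet in a tight set (δ⁺_D is submodular, D
-- is k-connected); good sets whose union is V meet in a good set (δ⁺_D − δ⁺_D′
-- is modular).  By uncrossing, the intersection I of the tight sets is good.
-- But δ⁺_D − δ⁺_D′ is also additive over vertices, and I contains v and no
-- deficient vertex, so I is not good.
module Submission where

open import Defs
open import Data.Nat using (ℕ; zero; suc; _+_; _*_; _≤_; _<_; z≤n; s≤s; _<?_)
open import Data.Nat.Properties
  using ( ≤-refl; ≤-trans; ≤-reflexive; ≤-pred; <-asym; <⇒≱; ≮⇒≥; ≤ᵇ⇒≤; m≤n+m; m<n⇒m<1+n; 0≢1+n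
        ; +-suc; +-identityʳ; *-zeroʳ; *-identityʳ
        ; +-mono-≤; +-monoˡ-≤; +-monoʳ-≤; +-monoˡ-<; +-mono-≤-<; +-mono-<-≤
        ; +-cancelˡ-≤; +-cancelʳ-≤; +-cancelˡ-<; +-cancelʳ-≡ )
open import Data.Nat.Tactic.RingSolver using (solve-∀)
open import Data.Nat.ListAction using (sum)
open import Data.Fin using (Fin; zero; suc; _≟_)
open import Data.Fin.Properties using (suc-injective; any?; all?; ¬∀⟶∃¬)
open import Data.Bool using (Bool; true; false; if_then_else_; _∧_; _∨_; not; _xor_)
open import Data.Bool.Properties using (∧-zeroʳ; ∧-assoc; ∨-zeroʳ; ∨-identityʳ; ¬-not) renaming (_≟_ to _≟ᵇ_)
open import Data.Unit using (tt)
open import Data.List using (List; []; _∷_; map; allFin; length)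
open import Data.List.Properties using (map-cong; map-tabulate; length-tabulate; length-removeAt′)
open import Data.List.Membership.Propositional using (_∈_; _∉_)
open import Data.List.Membership.Propositional.Properties using (∈-allFin)
open import Data.List.Relation.Unary.Any as Any using (Any; here; there) renaming (any? to anyᴸ?)
open import Data.List.Relation.Unary.All as All using (All; []; _∷_; lookup; lookupAny) renaming (all? to allᴸ?)
open import Data.List.Relation.Unary.All.Properties using (¬Any⇒All¬; ¬All⇒Any¬; ─⁺; anti-mono)
open import Data.List.Relation.Unary.AllPairs using ([]; _∷_)
open import Data.List.Relation.Unary.Unique.Propositional using (Unique)
open import Data.List.Relation.Binary.Subset.Propositional using (_⊆_)
import Data.Vec.Functional as Vector
open import Data.Product using (Σ; ∃; _×_; _,_; proj₁; proj₂; swap)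
open import Data.Sum using (_⊎_; inj₁; inj₂; [_,_])
open import Data.Empty using (⊥; ⊥-elim)
open import Function using (id)
open import Relation.Binary.PropositionalEquality hiding ([_])
open import Relation.Nullary using (Dec; yes; no; ¬_)
open import Relation.Nullary.Decidable using (⌊_⌋; ⌊⌋-map′)

ind : Bool → ℕ
ind b = if b then 1 else 0

sumOf : {A : Set} → List A → (A → ℕ) → ℕ
sumOf xs f = sum (map f xs)

-- The number of elements of xs satisfying P; outDegSet D X is literally
-- countIn (allFin m) (λ a → leaves X (D a)).
countIn : {A : Set} → List A → (A → Bool) → ℕ
countIn xs P = sumOf xs (λ a → ind (P a))

module _ {A : Set} where

  sumOf-cong : ∀ xs {f g : A → ℕ} → (∀ a → f a ≡ g a) → sumOf xs f ≡ sumOf xs g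
  sumOf-cong xs f≗g = cong sum (map-cong f≗g xs)

  sumOf-+ : ∀ xs (f g : A → ℕ) → sumOf xs (λ a → f a + g a) ≡ sumOf xs f + sumOf xs g
  sumOf-+ [] f g = refl
  sumOf-+ (x ∷ xs) f g = begin
    f x + g x + sumOf xs (λ a → f a + g a) ≡⟨ cong (f x + g x +_) (sumOf-+ xs f g) ⟩
    f x + g x + (sumOf xs f + sumOf xs g)  ≡⟨ interchange (f x) (g x) (sumOf xs f) (sumOf xs g) ⟩
    f x + sumOf xs f + (g x + sumOf xs g)  ∎
    where
    open ≡-Reasoning
    interchange : ∀ a b c d → a + b + (c + d) ≡ a + c + (b + d)
    interchange = solve-∀

  sumOf-+₃ : ∀ xs (f g h : A → ℕ) →
    sumOf xs (λ a → f a + g a + h a) ≡ sumOf xs f + sumOf xs g + sumOf xs h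
  sumOf-+₃ xs f g h = trans (sumOf-+ xs _ h) (cong (_+ sumOf xs h) (sumOf-+ xs f g))

  sumOf-0 : ∀ xs → sumOf xs (λ (_ : A) → 0) ≡ 0
  sumOf-0 [] = refl
  sumOf-0 (x ∷ xs) = sumOf-0 xs

  sumOf-mono : ∀ xs {f g : A → ℕ} → (∀ a → f a ≤ g a) → sumOf xs f ≤ sumOf xs g
  sumOf-mono [] f≤g = z≤n
  sumOf-mono (x ∷ xs) f≤g = +-mono-≤ (f≤g x) (sumOf-mono xs f≤g)

  sumOf-mono-< : ∀ {xs} {f g : A → ℕ} {y} → (∀ a → f a ≤ g a) → y ∈ xs → f y < g y →
                 sumOf xs f < sumOf xs g
  sumOf-mono-< {x ∷ xs} f≤g (here refl) fy<gy = +-mono-<-≤ fy<gy (sumOf-mono xs f≤g)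
  sumOf-mono-< {x ∷ xs} f≤g (there y∈xs) fy<gy = +-mono-≤-< (f≤g x) (sumOf-mono-< f≤g y∈xs fy<gy)

  countIn-cong : ∀ xs {P Q : A → Bool} → (∀ a → P a ≡ Q a) → countIn xs P ≡ countIn xs Q
  countIn-cong xs P≗Q = sumOf-cong xs (λ a → cong ind (P≗Q a))

  countIn-none : ∀ xs {P : A → Bool} → (∀ a → P a ≡ false) → countIn xs P ≡ 0
  countIn-none xs none = trans (countIn-cong xs none) (sumOf-0 xs)

  countIn-≤-length : ∀ xs (P : A → Bool) → countIn xs P ≤ length xs
  countIn-≤-length [] P = z≤n
  countIn-≤-length (x ∷ xs) P = +-mono-≤ (ind≤1 (P x)) (countIn-≤-length xs P)
    where
    ind≤1 : ∀ b → ind b ≤ 1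
    ind≤1 true = ≤-refl
    ind≤1 false = z≤n

sumOf-allFin-suc : ∀ {k} (h : Fin (suc k) → ℕ) → sumOf (allFin (suc k)) h ≡ h zero + sumOf (allFin k) (λ i → h (suc i))
sumOf-allFin-suc h = cong (h zero +_) (trans (cong sum (map-tabulate suc h)) (sym (cong sum (map-tabulate (λ i → i) (λ i → h (suc i))))))

sumOf-point : ∀ {k} (y : Fin k) (g : Fin k → ℕ) → sumOf (allFin k) (λ x → if ⌊ y ≟ x ⌋ then g x else 0) ≡ g y
sumOf-point {suc k} zero g = begin
  sumOf (allFin (suc k)) (λ x → if ⌊ zero ≟ x ⌋ then g x else 0) ≡⟨ sumOf-allFin-suc (λ x → if ⌊ zero ≟ x ⌋ then g x else 0) ⟩
  g zero + sumOf (allFin k) (λ _ → 0)                            ≡⟨ cong (g zero +_) (sumOf-0 (allFin k)) ⟩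
  g zero + 0                                                     ≡⟨ +-identityʳ (g zero) ⟩
  g zero                                                         ∎
  where open ≡-Reasoning
sumOf-point {suc k} (suc y) g = begin
  sumOf (allFin (suc k)) (λ x → if ⌊ suc y ≟ x ⌋ then g x else 0)    ≡⟨ sumOf-allFin-suc (λ x → if ⌊ suc y ≟ x ⌋ then g x else 0) ⟩
  sumOf (allFin k) (λ x → if ⌊ suc y ≟ suc x ⌋ then g (suc x) else 0) ≡⟨ sumOf-cong (allFin k) (λ x → cong (if_then g (suc x) else 0) (⌊⌋-map′ (cong suc) suc-injective (y ≟ x))) ⟩
  sumOf (allFin k) (λ x → if ⌊ y ≟ x ⌋ then g (suc x) else 0)         ≡⟨ sumOf-point y (λ x → g (suc x)) ⟩
  g (suc y)                                                          ∎
  where open ≡-Reasoning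

_∩_ : {A : Set} → (A → Bool) → (A → Bool) → A → Bool
(X ∩ Y) a = X a ∧ Y a

_∪_ : {A : Set} → (A → Bool) → (A → Bool) → A → Bool
(X ∪ Y) a = X a ∨ Y a

module _ {A : Set} where

  private
    if-0 : ∀ b → (if b then 0 else 0) ≡ 0
    if-0 true = refl
    if-0 false = refl

  countIn-modular : ∀ xs (P Q R : A → Bool) →
    countIn xs (λ a → (P a ∧ Q a) ∧ R a) + countIn xs (λ a → (P a ∨ Q a) ∧ R a)
    ≡ countIn xs (λ a → P a ∧ R a) + countIn xs (λ a → Q a ∧ R a)
  countIn-modular xs P Q R = begin
    countIn xs (λ a → (P a ∧ Q a) ∧ R a) + countIn xs (λ a → (P a ∨ Q a) ∧ R a)
      ≡⟨ sym (sumOf-+ xs _ _) ⟩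
    sumOf xs (λ a → ind ((P a ∧ Q a) ∧ R a) + ind ((P a ∨ Q a) ∧ R a))
      ≡⟨ sumOf-cong xs (λ a → modular (P a) (Q a) (R a)) ⟩
    sumOf xs (λ a → ind (P a ∧ R a) + ind (Q a ∧ R a))
      ≡⟨ sumOf-+ xs _ _ ⟩
    countIn xs (λ a → P a ∧ R a) + countIn xs (λ a → Q a ∧ R a) ∎
    where
    open ≡-Reasoning
    modular : ∀ p q r → ind ((p ∧ q) ∧ r) + ind ((p ∨ q) ∧ r) ≡ ind (p ∧ r) + ind (q ∧ r)
    modular true true r = refl
    modular true false r = sym (+-identityʳ (ind r))
    modular false true r = refl
    modular false false r = refl

  countIn-fibres : ∀ {k} (f : A → Fin k) (S : Fin k → Bool) (P : A → Bool) xs →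
    countIn xs (λ a → S (f a) ∧ P a)
    ≡ sumOf (allFin k) (λ x → if S x then countIn xs (λ a → ⌊ f a ≟ x ⌋ ∧ P a) else 0)
  countIn-fibres {k} f S P [] = sym (trans (sumOf-cong (allFin k) (λ x → if-0 (S x))) (sumOf-0 (allFin k)))
  countIn-fibres {k} f S P (a ∷ xs) = begin
    ind (S (f a) ∧ P a) + countIn xs (λ b → S (f b) ∧ P b)
      ≡⟨ cong₂ _+_ (sym single) (countIn-fibres f S P xs) ⟩
    sumOf (allFin k) (λ x → if S x then ind (⌊ f a ≟ x ⌋ ∧ P a) else 0) + sumOf (allFin k) (λ x → if S x then fibre x else 0)
      ≡⟨ sym (sumOf-+ (allFin k) _ _) ⟩
    sumOf (allFin k) (λ x → (if S x then ind (⌊ f a ≟ x ⌋ ∧ P a) else 0) + (if S x then fibre x else 0))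
      ≡⟨ sumOf-cong (allFin k) (λ x → if-+ (S x)) ⟩
    sumOf (allFin k) (λ x → if S x then ind (⌊ f a ≟ x ⌋ ∧ P a) + fibre x else 0) ∎
    where
    open ≡-Reasoning
    fibre : Fin k → ℕ
    fibre x = countIn xs (λ b → ⌊ f b ≟ x ⌋ ∧ P b)
    if-+ : ∀ b {u w} → (if b then u else 0) + (if b then w else 0) ≡ (if b then u + w else 0)
    if-+ true = refl
    if-+ false = refl
    at-fibre : ∀ x → (if S x then ind (⌊ f a ≟ x ⌋ ∧ P a) else 0) ≡ (if ⌊ f a ≟ x ⌋ then (if S x then ind (P a) else 0) else 0)
    at-fibre x with f a ≟ x
    ... | yes _ = refl
    ... | no _ = if-0 (S x)
    if-ind : ∀ b c → (if b then ind c else 0) ≡ ind (b ∧ c)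
    if-ind true c = refl
    if-ind false c = refl
    single : sumOf (allFin k) (λ x → if S x then ind (⌊ f a ≟ x ⌋ ∧ P a) else 0) ≡ ind (S (f a) ∧ P a)
    single = trans (sumOf-cong (allFin k) at-fibre)
                   (trans (sumOf-point (f a) (λ x → if S x then ind (P a) else 0)) (if-ind (S (f a)) (P a)))

leaves : ∀ {n} → (Fin n → Bool) → Fin n × Fin n → Bool
leaves X e = X (proj₁ e) ∧ not (X (proj₂ e))

complement : ∀ {n} → (Fin n → Bool) → Fin n → Bool
complement X y = not (X y)

singleton : ∀ {n} → Fin n → Fin n → Bool
singleton x y = ⌊ y ≟ x ⌋

singleton-self : ∀ {n} (x : Fin n) → singleton x x ≡ true
singleton-self x with x ≟ x
... | yes _ = refl
... | no x≢x = ⊥-elim (x≢x refl)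

module _ {n m : ℕ} {G : Digraph n m} where

  tail∈vertsOf : ∀ {u w b} (p : Walk G u w) → b ∈ arcsOf p → proj₁ (G b) ∈ vertsOf p
  tail∈vertsOf (step a e p) (here refl) = here e
  tail∈vertsOf (step a e p) (there b∈p) = there (tail∈vertsOf p b∈p)

  -- On a path the first arc is never used again, since its tail is not revisited.
  first-arc-fresh : ∀ {w} a (p : Walk G (proj₂ (G a)) w) →
                    Unique (proj₁ (G a) ∷ vertsOf p) → a ∉ arcsOf p
  first-arc-fresh a p (tail∉p ∷ _) a∈p = lookup tail∉p (tail∈vertsOf p a∈p) refl

  suffix : ∀ {u w x} (p : Walk G u w) → x ∈ vertsOf p → Unique (vertsOf p) →
           Σ (Path G x w) λ q → arcsOf (proj₁ q) ⊆ arcsOf p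
  suffix [] (here refl) unique = ([] , unique) , λ ()
  suffix (step a e p) (here refl) unique = (step a e p , unique) , λ b∈ → b∈
  suffix (step a e p) (there x∈p) (_ ∷ unique) with suffix p x∈p unique
  ... | q , q⊆p = q , λ b∈q → there (q⊆p b∈q)

  shortcut : ∀ {u w} (p : Walk G u w) → Σ (Path G u w) λ q → arcsOf (proj₁ q) ⊆ arcsOf p
  shortcut [] = ([] , ([] ∷ [])) , λ ()
  shortcut {u} (step a e p) with shortcut p
  ... | (q , unique) , q⊆p with anyᴸ? (u ≟_) (vertsOf q)
  ...   | yes u∈q with suffix q u∈q unique
  ...     | r , r⊆q = r , λ b∈r → there (q⊆p (r⊆q b∈r))
  shortcut {u} (step a e p) | (q , unique) , q⊆p | no u∉q =
    (step a e q , ¬Any⇒All¬ _ u∉q ∷ unique) , λ { (here refl) → here refl ; (there b∈q) → there (q⊆p b∈q) }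

-- The
-- proof grows the set of vertices from which t is reachable, one vertex at a
-- time, until no usable arc enters it.
module Reachability {n m : ℕ} (G : Digraph n m) (usable : Fin m → Bool) where

  UsableWalk : Fin n → Fin n → Set
  UsableWalk s t = Σ (Walk G s t) λ p → All (λ b → usable b ≡ true) (arcsOf p)

  Barrier : Fin n → Fin n → Set
  Barrier s t = Σ (Fin n → Bool) λ R → R s ≡ true × R t ≡ false ×
                  (∀ a → usable a ≡ true → leaves R (G a) ≡ false)

  private
    tl hd : Fin m → Fin n
    tl a = proj₁ (G a)
    hd a = proj₂ (G a)

    enters : (Fin n → Bool) → Fin m → Bool
    enters S a = usable a ∧ (S (hd a) ∧ not (S (tl a)))

    size : (Fin n → Bool) → ℕ
    size S = countIn (allFin n) S

    size-≤ : ∀ S → size S ≤ n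
    size-≤ S = ≤-trans (countIn-≤-length (allFin n) S) (≤-reflexive (length-tabulate (λ i → i)))

    size-grows : ∀ S x → S x ≡ false → size S < size (S ∪ singleton x)
    size-grows S x x∉S = sumOf-mono-< ind-∨ (∈-allFin x) at-x
      where
      ind-∨ : ∀ y → ind (S y) ≤ ind (S y ∨ singleton x y)
      ind-∨ y with S y
      ... | true = ≤-refl
      ... | false = z≤n
      at-x : ind (S x) < ind (S x ∨ singleton x x)
      at-x rewrite x∉S | singleton-self x = ≤-refl

    entering : ∀ {S a} → enters S a ≡ true → usable a ≡ true × S (hd a) ≡ true × S (tl a) ≡ false
    entering {S} {a} entry with usable a | S (hd a) | S (tl a)
    ... | true | true | false = refl , refl , refl

    complement-closed : ∀ S → (∀ a → enters S a ≢ true) →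
                        ∀ a → usable a ≡ true → leaves (complement S) (G a) ≡ false
    complement-closed S none a ua with S (tl a) in tl∈S | S (hd a) in hd∈S
    ... | true | _ = refl
    ... | false | false = refl
    ... | false | true = ⊥-elim (none a (cong₂ _∧_ ua (cong₂ (λ h t → h ∧ not t) hd∈S tl∈S)))

  module _ (t : Fin n) where

    -- Invariant: t is reachable from every vertex of S (and t ∈ S); the fuel
    -- bounds the number of vertices still missing from S.
    grow : ∀ fuel S → n ≤ size S + fuel → (∀ y → S y ≡ true → UsableWalk y t) → S t ≡ true →
           ∀ s → UsableWalk s t ⊎ Barrier s t
    grow fuel S bound walk t∈S s with any? (λ a → enters S a ≟ᵇ true)
    grow fuel S bound walk t∈S s | no none with S s in s∈S
    ... | true = inj₁ (walk s s∈S)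
    ... | false = inj₂ (complement S , cong not s∈S , cong not t∈S ,
                         complement-closed S (λ a entry → none (a , entry)))
    grow fuel S bound walk t∈S s | yes (a , entry)
      with ua , hd∈S , tl∉S ← entering {S} {a} entry = continue fuel bound
      where
      S′ : Fin n → Bool
      S′ = S ∪ singleton (tl a)

      walk′ : ∀ y → S y ∨ ⌊ y ≟ tl a ⌋ ≡ true → UsableWalk y t
      walk′ y y∈S′ with y ≟ tl a
      ... | yes refl = step a refl (proj₁ (walk (hd a) hd∈S)) , ua ∷ proj₂ (walk (hd a) hd∈S)
      ... | no _ = walk y (trans (sym (∨-identityʳ (S y))) y∈S′)

      larger : size S < size S′
      larger = size-grows S (tl a) tl∉S

      continue : ∀ fuel → n ≤ size S + fuel → UsableWalk s t ⊎ Barrier s t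
      continue zero bound = ⊥-elim (<⇒≱ (≤-trans larger (size-≤ S′)) (subst (n ≤_) (+-identityʳ (size S)) bound))
      continue (suc fuel) bound =
        grow fuel S′ (≤-trans bound (≤-trans (≤-reflexive (+-suc (size S) fuel)) (+-monoˡ-≤ fuel larger)))
             walk′ (cong (_∨ _) t∈S) s

    reach : ∀ s → UsableWalk s t ⊎ Barrier s t
    reach = grow n (singleton t) (m≤n+m n (size (singleton t))) walk₀ (singleton-self t)
      where
      walk₀ : ∀ y → ⌊ y ≟ t ⌋ ≡ true → UsableWalk y t
      walk₀ y y≡t with y ≟ t
      ... | yes refl = [] , []

-- Proof by augmenting 0/1 flows (Ford–Fulkerson) followed by decomposition of
-- the final flow into paths.
module Menger {n m : ℕ} (D : Digraph n m) where

  open import Data.List.Membership.DecPropositional (_≟_ {m}) using (_∈?_)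

  PairwiseDisjoint : ∀ {s t r} → (Fin r → Path D s t) → Set
  PairwiseDisjoint P = ∀ i j → i ≢ j → ∀ (a : Fin m) → a ∈ arcsOf (proj₁ (P i)) → a ∉ arcsOf (proj₁ (P j))

  -- A 0/1 flow: the set of arcs carrying one unit.
  Flow : Set
  Flow = Fin m → Bool

  flowOut flowIn : Flow → (Fin n → Bool) → ℕ
  flowOut f X = countIn (allFin m) (λ a → f a ∧ leaves X (D a))
  flowIn f X = flowOut f (complement X)

  residual : Flow → Digraph n m
  residual f a = if f a then swap (D a) else D a

  residual-used : ∀ f a → f a ≡ true → residual f a ≡ swap (D a)
  residual-used f a fa = cong (if_then swap (D a) else D a) fa

  residual-free : ∀ f a → f a ≡ false → residual f a ≡ D a
  residual-free f a fa = cong (if_then swap (D a) else D a) fa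

  toggle : Flow → Fin m → Flow
  toggle f a b = if ⌊ a ≟ b ⌋ then not (f b) else f b

  toggle-elsewhere : ∀ f a b → a ≢ b → toggle f a b ≡ f b
  toggle-elsewhere f a b a≢b with a ≟ b
  ... | yes a≡b = ⊥-elim (a≢b a≡b)
  ... | no _ = refl

  toggle-here : ∀ f a → toggle f a a ≡ not (f a)
  toggle-here f a with a ≟ a
  ... | yes _ = refl
  ... | no a≢a = ⊥-elim (a≢a refl)

  -- g arises from f by sending one more unit of flow from y to z: across every
  -- cut X the net flow changes by [y ∈ X] − [z ∈ X].
  record Shift (f g : Flow) (y z : Fin n) : Set where
    constructor mkShift
    field
      shifted : ∀ X → flowOut g X + flowIn f X + ind (X z) ≡ flowOut f X + flowIn g X + ind (X y)
  open Shift

  shift-refl : ∀ {f y} → Shift f f y y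
  shift-refl = mkShift λ X → refl

  shift-trans : ∀ {f g h x y z} → Shift f g x y → Shift g h y z → Shift f h x z
  shift-trans {f} {g} {h} {x} {y} {z} f→g g→h = mkShift λ X →
    +-cancelʳ-≡ (flowOut g X + flowIn g X + ind (X y)) _ _ (begin
      flowOut h X + flowIn f X + ind (X z) + (flowOut g X + flowIn g X + ind (X y))
        ≡⟨ regroup (flowOut h X) (flowIn f X) (ind (X z)) (flowOut g X) (flowIn g X) (ind (X y)) ⟩
      (flowOut g X + flowIn f X + ind (X y)) + (flowOut h X + flowIn g X + ind (X z))
        ≡⟨ cong₂ _+_ (shifted f→g X) (shifted g→h X) ⟩
      (flowOut f X + flowIn g X + ind (X x)) + (flowOut g X + flowIn h X + ind (X y))
        ≡⟨ regroup′ (flowOut f X) (flowIn g X) (ind (X x)) (flowOut g X) (flowIn h X) (ind (X y)) ⟩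
      flowOut f X + flowIn h X + ind (X x) + (flowOut g X + flowIn g X + ind (X y)) ∎)
    where
    open ≡-Reasoning
    regroup : ∀ a b c d e w → a + b + c + (d + e + w) ≡ (d + b + w) + (a + e + c)
    regroup = solve-∀
    regroup′ : ∀ a b c d e w → (a + b + c) + (d + e + w) ≡ a + e + c + (d + b + w)
    regroup′ = solve-∀

  toggle-shift : ∀ f a → Shift f (toggle f a) (proj₁ (residual f a)) (proj₂ (residual f a))
  toggle-shift f a = mkShift toggled
    where
    g : Flow
    g = toggle f a
    y z : Fin n
    y = proj₁ (residual f a)
    z = proj₂ (residual f a)
    balance : ∀ X φ (e : Fin n × Fin n) →
      ind (not φ ∧ leaves X e) + ind (φ ∧ leaves (complement X) e) + ind (X (proj₂ (if φ then swap e else e)))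
      ≡ ind (φ ∧ leaves X e) + ind (not φ ∧ leaves (complement X) e) + ind (X (proj₁ (if φ then swap e else e)))
    balance X true e with X (proj₁ e) | X (proj₂ e)
    ... | true | true = refl
    ... | true | false = refl
    ... | false | true = refl
    ... | false | false = refl
    balance X false e with X (proj₁ e) | X (proj₂ e)
    ... | true | true = refl
    ... | true | false = refl
    ... | false | true = refl
    ... | false | false = refl
    at : ∀ X b → ind (g b ∧ leaves X (D b)) + ind (f b ∧ leaves (complement X) (D b)) + (if ⌊ a ≟ b ⌋ then ind (X z) else 0)
               ≡ ind (f b ∧ leaves X (D b)) + ind (g b ∧ leaves (complement X) (D b)) + (if ⌊ a ≟ b ⌋ then ind (X y) else 0)
    at X b with a ≟ b
    ... | yes refl = balance X (f a) (D a)
    ... | no _ = refl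
    toggled : ∀ X → flowOut g X + flowIn f X + ind (X z) ≡ flowOut f X + flowIn g X + ind (X y)
    toggled X = begin
      flowOut g X + flowIn f X + ind (X z)
        ≡⟨ cong (flowOut g X + flowIn f X +_) (sym (sumOf-point a (λ _ → ind (X z)))) ⟩
      flowOut g X + flowIn f X + sumOf (allFin m) (λ b → if ⌊ a ≟ b ⌋ then ind (X z) else 0)
        ≡⟨ sym (sumOf-+₃ (allFin m) _ _ (λ b → if ⌊ a ≟ b ⌋ then ind (X z) else 0)) ⟩
      sumOf (allFin m) (λ b → ind (g b ∧ leaves X (D b)) + ind (f b ∧ leaves (complement X) (D b))
                                + (if ⌊ a ≟ b ⌋ then ind (X z) else 0))
        ≡⟨ sumOf-cong (allFin m) (at X) ⟩
      sumOf (allFin m) (λ b → ind (f b ∧ leaves X (D b)) + ind (g b ∧ leaves (complement X) (D b))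
                                + (if ⌊ a ≟ b ⌋ then ind (X y) else 0))
        ≡⟨ sumOf-+₃ (allFin m) _ _ (λ b → if ⌊ a ≟ b ⌋ then ind (X y) else 0) ⟩
      flowOut f X + flowIn g X + sumOf (allFin m) (λ b → if ⌊ a ≟ b ⌋ then ind (X y) else 0)
        ≡⟨ cong (flowOut f X + flowIn g X +_) (sumOf-point a (λ _ → ind (X y))) ⟩
      flowOut f X + flowIn g X + ind (X y) ∎
      where open ≡-Reasoning

  -- The path may be taken in the residual digraph of an earlier flow g,
  -- as long as f agrees with g on the arcs still to be toggled.
  augment : ∀ g f {y z} (p : Walk (residual g) y z) → Unique (vertsOf p) →
            (∀ {b} → b ∈ arcsOf p → f b ≡ g b) → Σ Flow λ f′ → Shift f f′ y z
  augment g f [] _ _ = f , shift-refl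
  augment g f (step a refl p) unique@(_ ∷ unique′) agree
    with augment g (toggle f a) p unique′ agree′
    where
    agree′ : ∀ {b} → b ∈ arcsOf p → toggle f a b ≡ g b
    agree′ {b} b∈p = trans (toggle-elsewhere f a b (λ { refl → first-arc-fresh a p unique b∈p })) (agree (there b∈p))
  ... | f′ , rest = f′ , shift-trans first rest
    where
    same-residual : residual f a ≡ residual g a
    same-residual = cong (if_then swap (D a) else D a) (agree (here refl))
    first : Shift f (toggle f a) (proj₁ (residual g a)) (proj₂ (residual g a))
    first = subst (λ e → Shift f (toggle f a) (proj₁ e) (proj₂ e)) same-residual (toggle-shift f a)

  cancel : ∀ f {y z} (p : Walk D y z) → Unique (vertsOf p) → All (λ b → f b ≡ true) (arcsOf p) →
           Σ Flow λ f′ → Shift f f′ z y × (∀ {b} → b ∉ arcsOf p → f′ b ≡ f b)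
                                        × (∀ {b} → b ∈ arcsOf p → f′ b ≡ false)
  cancel f [] _ _ = f , shift-refl , (λ _ → refl) , λ ()
  cancel f (step a refl p) unique@(_ ∷ unique′) (fa ∷ fp) with cancel f p unique′ fp
  ... | f₁ , shift₁ , same₁ , gone₁ = toggle f₁ a , shift-trans shift₁ last , same , gone
    where
    a∉p : a ∉ arcsOf p
    a∉p = first-arc-fresh a p unique
    f₁a : f₁ a ≡ true
    f₁a = trans (same₁ a∉p) fa
    last : Shift f₁ (toggle f₁ a) (proj₂ (D a)) (proj₁ (D a))
    last = subst (λ e → Shift f₁ (toggle f₁ a) (proj₁ e) (proj₂ e)) (residual-used f₁ a f₁a) (toggle-shift f₁ a)
    same : ∀ {b} → b ∉ arcsOf (step a refl p) → toggle f₁ a b ≡ f b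
    same {b} b∉ = trans (toggle-elsewhere f₁ a b (λ { refl → b∉ (here refl) })) (same₁ (λ b∈p → b∉ (there b∈p)))
    gone : ∀ {b} → b ∈ arcsOf (step a refl p) → toggle f₁ a b ≡ false
    gone (here refl) = trans (toggle-here f₁ a) (cong not f₁a)
    gone {b} (there b∈p) = trans (toggle-elsewhere f₁ a b (λ { refl → a∉p b∈p })) (gone₁ b∈p)

  module _ (s t : Fin n) where

    -- f is an s–t flow of value r: for every vertex set X, the flow leaving X
    -- minus the flow entering it is r · ([s ∈ X] − [t ∈ X]).
    record IsFlow (r : ℕ) (f : Flow) : Set where
      constructor mkIsFlow
      field
        conserved : ∀ X → flowOut f X + r * ind (X t) ≡ flowIn f X + r * ind (X s)
    open IsFlow

    flow-grow : ∀ {r f g} → IsFlow r f → Shift f g s t → IsFlow (suc r) g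
    flow-grow {r} {f} {g} flow shift = mkIsFlow grown
      where
      grown : ∀ X → flowOut g X + suc r * ind (X t) ≡ flowIn g X + suc r * ind (X s)
      grown X = +-cancelʳ-≡ (flowOut f X + flowIn f X) _ _ (begin
          flowOut g X + (T + r * T) + (flowOut f X + flowIn f X)
            ≡⟨ regroup (flowOut g X) (flowIn f X) (flowOut f X) T r ⟩
          (flowOut g X + flowIn f X + T) + (flowOut f X + r * T)
            ≡⟨ cong₂ _+_ (shifted shift X) (conserved flow X) ⟩
          (flowOut f X + flowIn g X + S) + (flowIn f X + r * S)
            ≡⟨ regroup′ (flowIn g X) (flowIn f X) (flowOut f X) S r ⟩
          flowIn g X + (S + r * S) + (flowOut f X + flowIn f X) ∎)
        where
        open ≡-Reasoning
        S = ind (X s)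
        T = ind (X t)
        regroup : ∀ a b c T r → a + (T + r * T) + (c + b) ≡ (a + b + T) + (c + r * T)
        regroup = solve-∀
        regroup′ : ∀ d b c S r → (c + d + S) + (b + r * S) ≡ d + (S + r * S) + (c + b)
        regroup′ = solve-∀

    flow-shrink : ∀ {r f g} → IsFlow (suc r) f → Shift f g t s → IsFlow r g
    flow-shrink {r} {f} {g} flow shift = mkIsFlow shrunk
      where
      shrunk : ∀ X → flowOut g X + r * ind (X t) ≡ flowIn g X + r * ind (X s)
      shrunk X = +-cancelʳ-≡ (flowOut f X + flowIn f X + S + T) _ _ (begin
          flowOut g X + r * T + (flowOut f X + flowIn f X + S + T)
            ≡⟨ regroup (flowOut g X) (flowIn f X) (flowOut f X) S T r ⟩
          (flowOut g X + flowIn f X + S) + (flowOut f X + (T + r * T))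
            ≡⟨ cong₂ _+_ (shifted shift X) (conserved flow X) ⟩
          (flowOut f X + flowIn g X + T) + (flowIn f X + (S + r * S))
            ≡⟨ regroup′ (flowIn g X) (flowIn f X) (flowOut f X) S T r ⟩
          flowIn g X + r * S + (flowOut f X + flowIn f X + S + T) ∎)
        where
        open ≡-Reasoning
        S = ind (X s)
        T = ind (X t)
        regroup : ∀ a b c S T r → a + r * T + (c + b + S + T) ≡ (a + b + S) + (c + (T + r * T))
        regroup = solve-∀
        regroup′ : ∀ d b c S T r → (c + d + T) + (b + (S + r * S)) ≡ d + r * S + (c + b + S + T)
        regroup′ = solve-∀

    SmallCut : ℕ → Set
    SmallCut r = Σ (Fin n → Bool) λ X → X s ≡ true × X t ≡ false × outDegSet D X < r

    -- A set that no residual arc leaves is saturated: every arc leaving it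
    -- carries flow and no arc entering it does; so its out-degree is the value.
    saturated-cut : ∀ {r f} R → IsFlow r f → R s ≡ true → R t ≡ false →
                    (∀ a → leaves R (residual f a) ≡ false) → outDegSet D R ≡ r
    saturated-cut {r} {f} R flow Rs Rt closed = begin
      outDegSet D R                 ≡⟨ sym full-out ⟩
      flowOut f R                   ≡⟨ sym (+-identityʳ _) ⟩
      flowOut f R + 0               ≡⟨ cong (flowOut f R +_) (sym (*-zeroʳ r)) ⟩
      flowOut f R + r * 0           ≡⟨ cong (λ b → flowOut f R + r * ind b) (sym Rt) ⟩
      flowOut f R + r * ind (R t)   ≡⟨ conserved flow R ⟩
      flowIn f R + r * ind (R s)    ≡⟨ cong₂ (λ i b → i + r * ind b) empty-in Rs ⟩
      r * 1                         ≡⟨ *-identityʳ r ⟩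
      r                             ∎
      where
      open ≡-Reasoning
      full-out : flowOut f R ≡ outDegSet D R
      full-out = countIn-cong (allFin m) at
        where
        at : ∀ a → f a ∧ leaves R (D a) ≡ leaves R (D a)
        at a with f a in fa
        ... | true = refl
        ... | false = sym (subst (λ e → leaves R e ≡ false) (residual-free f a fa) (closed a))
      empty-in : flowIn f R ≡ 0
      empty-in = countIn-none (allFin m) at
        where
        reversed-blocked : ∀ x y → R y ∧ not (R x) ≡ false → not (R x) ∧ not (not (R y)) ≡ false
        reversed-blocked x y blocked with R x | R y
        ... | true | _ = refl
        ... | false | false = refl
        at : ∀ a → f a ∧ leaves (complement R) (D a) ≡ false
        at a with f a in fa
        ... | false = refl
        ... | true = reversed-blocked (proj₁ (D a)) (proj₂ (D a))
                       (subst (λ e → leaves R e ≡ false) (residual-used f a fa) (closed a))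

    saturate : ∀ r → Σ Flow (IsFlow r) ⊎ SmallCut r
    saturate zero = inj₁ ((λ _ → false) , mkIsFlow λ X → refl)
    saturate (suc r) with saturate r
    ... | inj₂ (X , Xs , Xt , small) = inj₂ (X , Xs , Xt , m<n⇒m<1+n small)
    ... | inj₁ (f , flow) with Reachability.reach (residual f) (λ _ → true) t s
    ...   | inj₂ (R , Rs , Rt , closed) =
            inj₂ (R , Rs , Rt , ≤-reflexive (cong suc (saturated-cut R flow Rs Rt (λ a → closed a refl))))
    ...   | inj₁ (w , _) with shortcut w
    ...     | (p , unique) , _ with augment f f p unique (λ _ → refl)
    ...       | g , shift = inj₁ (g , flow-grow flow shift)

    flow-escapes : ∀ {r f} R → IsFlow (suc r) f → R s ≡ true → R t ≡ false →
                   (∀ a → f a ≡ true → leaves R (D a) ≡ false) → ⊥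
    flow-escapes {r} {f} R flow Rs Rt closed = 0≢1+n (trans no-outflow (+-suc _ _))
      where
      open ≡-Reasoning
      blocked : ∀ a → f a ∧ leaves R (D a) ≡ false
      blocked a with f a in fa
      ... | true = closed a fa
      ... | false = refl
      no-outflow : 0 ≡ flowIn f R + suc r * 1
      no-outflow = begin
        0                                 ≡⟨ sym (*-zeroʳ (suc r)) ⟩
        suc r * 0                         ≡⟨ cong₂ (λ o b → o + suc r * ind b) (sym (countIn-none (allFin m) blocked)) (sym Rt) ⟩
        flowOut f R + suc r * ind (R t)   ≡⟨ conserved flow R ⟩
        flowIn f R + suc r * ind (R s)    ≡⟨ cong (λ b → flowIn f R + suc r * ind b) Rs ⟩
        flowIn f R + suc r * 1            ∎

    add-path : ∀ {r} (f : Flow) (p : Path D s t) → (∀ {b} → b ∈ arcsOf (proj₁ p) → f b ≡ false) →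
               (P : Fin r → Path D s t) → PairwiseDisjoint P → (∀ i → All (λ b → f b ≡ true) (arcsOf (proj₁ (P i)))) →
               PairwiseDisjoint (p Vector.∷ P)
    add-path f p outside P disjoint inside = disjoint′
      where
      disjoint′ : PairwiseDisjoint (p Vector.∷ P)
      disjoint′ zero zero i≢j = ⊥-elim (i≢j refl)
      disjoint′ zero (suc j) _ b b∈p b∈Pj with () ← trans (sym (outside b∈p)) (lookup (inside j) b∈Pj)
      disjoint′ (suc i) zero _ b b∈Pi b∈p with () ← trans (sym (outside b∈p)) (lookup (inside i) b∈Pi)
      disjoint′ (suc i) (suc j) i≢j = disjoint i j (λ i≡j → i≢j (cong suc i≡j))

    -- A flow of value r decomposes into r arc-disjoint s–t paths along its
    -- arcs: find an s–t path of flow arcs, cancel it, and recurse.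
    decompose : ∀ r f → IsFlow r f →
                Σ (Fin r → Path D s t) λ P → PairwiseDisjoint P × (∀ i → All (λ b → f b ≡ true) (arcsOf (proj₁ (P i))))
    decompose zero f _ = (λ ()) , (λ ()) , λ ()
    decompose (suc r) f flow with Reachability.reach D f t s
    ... | inj₂ (R , Rs , Rt , closed) = ⊥-elim (flow-escapes R flow Rs Rt closed)
    ... | inj₁ (w , w-in-f) with shortcut w
    ... | p , p⊆w with cancel f (proj₁ p) (proj₂ p) (anti-mono p⊆w w-in-f)
    ... | f′ , shift , same , gone with decompose r f′ (flow-shrink flow shift)
    ... | P , disjoint , in-f′ = p Vector.∷ P , add-path f′ p gone P disjoint in-f′ , in-f
      where
      f′⊆f : ∀ {b} → f′ b ≡ true → f b ≡ true
      f′⊆f {b} f′b with b ∈? arcsOf (proj₁ p)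
      ... | yes b∈p with () ← trans (sym (gone b∈p)) f′b
      ... | no b∉p = trans (sym (same b∉p)) f′b
      in-f : ∀ i → All (λ b → f b ≡ true) (arcsOf (proj₁ ((p Vector.∷ P) i)))
      in-f zero = anti-mono p⊆w w-in-f
      in-f (suc i) = All.map f′⊆f (in-f′ i)

    menger : ∀ r → DisjointPaths D s t r ⊎ SmallCut r
    menger r with saturate r
    ... | inj₂ cut = inj₂ cut
    ... | inj₁ (f , flow) with decompose r f flow
    ...   | P , disjoint , _ = inj₁ (P , disjoint)

outDegSet-submodular : ∀ {n m} (G : Digraph n m) X Y →
  outDegSet G (X ∩ Y) + outDegSet G (X ∪ Y) ≤ outDegSet G X + outDegSet G Y
outDegSet-submodular {m = m} G X Y =
  ≤-trans (≤-reflexive (sym (sumOf-+ (allFin m) _ _)))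
    (≤-trans (sumOf-mono (allFin m) (λ a → at (X (proj₁ (G a))) (Y (proj₁ (G a))) (X (proj₂ (G a))) (Y (proj₂ (G a)))))
             (≤-reflexive (sumOf-+ (allFin m) _ _)))
  where
  at : ∀ x y x′ y′ → ind ((x ∧ y) ∧ not (x′ ∧ y′)) + ind ((x ∨ y) ∧ not (x′ ∨ y′)) ≤ ind (x ∧ not x′) + ind (y ∧ not y′)
  at true  true  true  true  = ≤ᵇ⇒≤ _ _ tt
  at true  true  true  false = ≤ᵇ⇒≤ _ _ tt
  at true  true  false true  = ≤ᵇ⇒≤ _ _ tt
  at true  true  false false = ≤ᵇ⇒≤ _ _ tt
  at true  false true  true  = ≤ᵇ⇒≤ _ _ tt
  at true  false true  false = ≤ᵇ⇒≤ _ _ tt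
  at true  false false true  = ≤ᵇ⇒≤ _ _ tt
  at true  false false false = ≤ᵇ⇒≤ _ _ tt
  at false true  true  true  = ≤ᵇ⇒≤ _ _ tt
  at false true  true  false = ≤ᵇ⇒≤ _ _ tt
  at false true  false true  = ≤ᵇ⇒≤ _ _ tt
  at false true  false false = ≤ᵇ⇒≤ _ _ tt
  at false false _     _     = z≤n

Covers : ∀ {n} → (Fin n → Bool) → (Fin n → Bool) → Set
Covers X Y = ∀ y → (X ∪ Y) y ≡ true

trade-≤ : ∀ {a b c d} → a + b ≡ c + d → a ≤ c → d ≤ b
trade-≤ {a} {b} {c} {d} eq a≤c = +-cancelˡ-≤ c d b (≤-trans (≤-reflexive (sym eq)) (+-monoˡ-≤ b a≤c))

trade-< : ∀ {a b c d} → a + b ≡ c + d → a < c → d < b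
trade-< {a} {b} {c} {d} eq a<c = +-cancelˡ-< c d b (≤-trans (s≤s (≤-reflexive (sym eq))) (+-monoˡ-< b a<c))

-- Across any vertex set S, the difference of their
-- out-degrees is the number of reversed arcs with (D-)tail in S minus the
-- number with head in S; these two counts are modular in S and add up over
-- the vertices of S.
module Reorientation {n m : ℕ} (ends : Fin m → Fin n × Fin n) (o o′ : Fin m → Bool) where

  D D′ : Digraph n m
  D = orient ends o
  D′ = orient ends o′

  reversed : Fin m → Bool
  reversed a = o a xor o′ a

  revOut revIn : (Fin n → Bool) → ℕ
  revOut S = countIn (allFin m) (λ a → S (proj₁ (D a)) ∧ reversed a)
  revIn S = countIn (allFin m) (λ a → S (proj₂ (D a)) ∧ reversed a)

  reversal-balance : ∀ S → outDegSet D S + revIn S ≡ outDegSet D′ S + revOut S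
  reversal-balance S = begin
    outDegSet D S + revIn S
      ≡⟨ sym (sumOf-+ (allFin m) _ _) ⟩
    sumOf (allFin m) (λ a → ind (leaves S (D a)) + ind (S (proj₂ (D a)) ∧ reversed a))
      ≡⟨ sumOf-cong (allFin m) (λ a → at (o a) (o′ a) (ends a)) ⟩
    sumOf (allFin m) (λ a → ind (leaves S (D′ a)) + ind (S (proj₁ (D a)) ∧ reversed a))
      ≡⟨ sumOf-+ (allFin m) _ _ ⟩
    outDegSet D′ S + revOut S ∎
    where
    open ≡-Reasoning
    -- an arc (x , y) leaves S exactly when its reversal does, up to [y ∈ S] − [x ∈ S]
    crossing : ∀ x y → ind (x ∧ not y) + ind (y ∧ true) ≡ ind (y ∧ not x) + ind (x ∧ true)
    crossing true true = refl
    crossing true false = refl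
    crossing false true = refl
    crossing false false = refl
    unreversed : ∀ x y → ind (y ∧ false) ≡ ind (x ∧ false)
    unreversed x y = trans (cong ind (∧-zeroʳ y)) (sym (cong ind (∧-zeroʳ x)))
    at : ∀ p q (e : Fin n × Fin n) →
      ind (leaves S (if p then e else swap e)) + ind (S (proj₂ (if p then e else swap e)) ∧ (p xor q))
      ≡ ind (leaves S (if q then e else swap e)) + ind (S (proj₁ (if p then e else swap e)) ∧ (p xor q))
    at true true e = cong (ind (leaves S e) +_) (unreversed (S (proj₁ e)) (S (proj₂ e)))
    at false false e = cong (ind (leaves S (swap e)) +_) (unreversed (S (proj₂ e)) (S (proj₁ e)))
    at true false e = crossing (S (proj₁ e)) (S (proj₂ e))
    at false true e = sym (crossing (S (proj₁ e)) (S (proj₂ e)))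

  -- Good S: δ⁺_D(S) ≤ δ⁺_D′(S), stated through the reversed arcs.
  Good : (Fin n → Bool) → Set
  Good S = revOut S ≤ revIn S

  good : ∀ {S} → outDegSet D S ≤ outDegSet D′ S → Good S
  good {S} = trade-≤ (reversal-balance S)

  -- No arc leaves the whole vertex set.
  good-everything : Good (λ _ → true)
  good-everything = ≤-refl

  good-ext : ∀ X Y → (∀ y → X y ≡ Y y) → Good X → Good Y
  good-ext X Y X≗Y = subst₂ _≤_ (countIn-cong (allFin m) (λ a → cong (_∧ reversed a) (X≗Y (proj₁ (D a)))))
                                    (countIn-cong (allFin m) (λ a → cong (_∧ reversed a) (X≗Y (proj₂ (D a)))))

  good-meet : ∀ X Y → Good X → Good Y → Covers X Y → Good (X ∩ Y)
  good-meet X Y goodX goodY covering = +-cancelʳ-≤ (revOut (X ∪ Y)) (revOut (X ∩ Y)) (revIn (X ∩ Y)) (begin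
    revOut (X ∩ Y) + revOut (X ∪ Y) ≡⟨ countIn-modular (allFin m) (X ∘tl) (Y ∘tl) reversed ⟩
    revOut X + revOut Y              ≤⟨ +-mono-≤ goodX goodY ⟩
    revIn X + revIn Y                ≡⟨ sym (countIn-modular (allFin m) (X ∘hd) (Y ∘hd) reversed) ⟩
    revIn (X ∩ Y) + revIn (X ∪ Y)    ≡⟨ cong (revIn (X ∩ Y) +_) (trans (all-reversed proj₂) (sym (all-reversed proj₁))) ⟩
    revIn (X ∩ Y) + revOut (X ∪ Y)   ∎)
    where
    open Data.Nat.Properties.≤-Reasoning
    _∘tl _∘hd : (Fin n → Bool) → Fin m → Bool
    (S ∘tl) a = S (proj₁ (D a))
    (S ∘hd) a = S (proj₂ (D a))
    all-reversed : (end : Fin n × Fin n → Fin n) →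
                   countIn (allFin m) (λ a → (X ∪ Y) (end (D a)) ∧ reversed a) ≡ countIn (allFin m) reversed
    all-reversed end = countIn-cong (allFin m) (λ a → cong (_∧ reversed a) (covering (end (D a))))

  -- A set containing v, in which no vertex has smaller out-degree in D than
  -- in D′ and v has larger, is not good: add up the vertex contributions.
  not-good : ∀ {S v} → S v ≡ true → outDeg D′ v < outDeg D v →
             (∀ x → S x ≡ true → outDeg D′ x ≤ outDeg D x) → revIn S < revOut S
  not-good {S} {v} v∈S v-surplus no-deficit = begin-strict
    revIn S                                                                ≡⟨ countIn-fibres (λ a → proj₂ (D a)) S reversed (allFin m) ⟩
    sumOf (allFin n) (λ x → if S x then revIn (singleton x) else 0)        <⟨ sumOf-mono-< vertexwise (∈-allFin v) at-v ⟩
    sumOf (allFin n) (λ x → if S x then revOut (singleton x) else 0)       ≡⟨ sym (countIn-fibres (λ a → proj₁ (D a)) S reversed (allFin m)) ⟩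
    revOut S                                                               ∎
    where
    open Data.Nat.Properties.≤-Reasoning
    vertexwise : ∀ x → (if S x then revIn (singleton x) else 0) ≤ (if S x then revOut (singleton x) else 0)
    vertexwise x with S x in x∈S
    ... | true = trade-≤ (sym (reversal-balance (singleton x))) (no-deficit x x∈S)
    ... | false = z≤n
    at-v : (if S v then revIn (singleton v) else 0) < (if S v then revOut (singleton v) else 0)
    at-v rewrite v∈S = trade-< (sym (reversal-balance (singleton v))) v-surplus

⋂ : ∀ {n} → List (Fin n → Bool) → Fin n → Bool
⋂ [] y = true
⋂ (X ∷ Xs) = X ∩ ⋂ Xs

-- Let Tight and Good be properties of vertex sets such that
-- tight sets are good, two tight sets not covering V meet in a tight set,
-- and two good sets covering V meet in a good set.  Then the intersection of
-- any finite family of tight sets is good: repeatedly merge a member with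
-- one it does not cover, until the first member covers all others.
module Uncrossing {n : ℕ} (Tight Good : (Fin n → Bool) → Set)
  (good-ext : ∀ X Y → (∀ y → X y ≡ Y y) → Good X → Good Y)
  (good-everything : Good (λ _ → true))
  (tight⇒good : ∀ X → Tight X → Good X)
  (tight-meet : ∀ X Y → Tight X → Tight Y → (∃ λ y → (X ∪ Y) y ≡ false) → Tight (X ∩ Y))
  (good-meet : ∀ X Y → Good X → Good Y → Covers X Y → Good (X ∩ Y))
  where

  private
    covers? : ∀ (X Y : Fin n → Bool) → Dec (Covers X Y)
    covers? X Y = all? {P = λ y → (X ∪ Y) y ≡ true} (λ y → (X ∪ Y) y ≟ᵇ true)

    uncovered : ∀ {X Y} → ¬ Covers X Y → ∃ λ y → (X ∪ Y) y ≡ false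
    uncovered {X} {Y} ¬covers with ¬∀⟶∃¬ n (λ y → (X ∪ Y) y ≡ true) (λ y → (X ∪ Y) y ≟ᵇ true) ¬covers
    ... | y , y∉ = y , ¬-not y∉

    covers-⋂ : ∀ (X : Fin n → Bool) Ys → All (Covers X) Ys → Covers X (⋂ Ys)
    covers-⋂ X [] [] y = ∨-zeroʳ (X y)
    covers-⋂ X (Y ∷ Ys) (covY ∷ covYs) y with X y in Xy
    ... | true = refl
    ... | false = cong₂ _∧_ (subst (λ b → b ∨ Y y ≡ true) Xy (covY y))
                            (subst (λ b → b ∨ ⋂ Ys y ≡ true) Xy (covers-⋂ X Ys covYs y))

    ∧-left-comm : ∀ a b c → a ∧ (b ∧ c) ≡ b ∧ (a ∧ c)
    ∧-left-comm true b c = refl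
    ∧-left-comm false b c = sym (∧-zeroʳ b)

    ⋂-─ : ∀ {P : (Fin n → Bool) → Set} {Ys} (p : Any P Ys) y → ⋂ Ys y ≡ Any.lookup p y ∧ ⋂ (Ys Any.─ p) y
    ⋂-─ (here _) y = refl
    ⋂-─ {Ys = Y ∷ Ys} (there p) y =
      trans (cong (Y y ∧_) (⋂-─ p y)) (∧-left-comm (Y y) (Any.lookup p y) (⋂ (Ys Any.─ p) y))

    -- Induction on the size N of the family; merging shrinks it by one.
    ⋂-good′ : ∀ N (Xs : List (Fin n → Bool)) → length Xs ≤ N → All Tight Xs → Good (⋂ Xs)
    ⋂-good′ _ [] _ _ = good-everything
    ⋂-good′ (suc N) (X ∷ Ys) (s≤s size) (tightX ∷ tightYs) with allᴸ? (covers? X) Ys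
    ... | yes covered = good-meet X (⋂ Ys) (tight⇒good X tightX) (⋂-good′ N Ys size tightYs) (covers-⋂ X Ys covered)
    ... | no ¬covered = good-ext _ _ regroup (⋂-good′ N ((X ∩ Y) ∷ (Ys Any.─ p)) smaller
                                          (tight-meet X Y tightX tightY (uncovered {X} {Y} ¬coversY) ∷ ─⁺ p tightYs))
      where
      p : Any (λ Y → ¬ Covers X Y) Ys
      p = ¬All⇒Any¬ (covers? X) Ys ¬covered
      Y : Fin n → Bool
      Y = Any.lookup p
      tightY : Tight Y
      tightY = proj₁ (lookupAny tightYs p)
      ¬coversY : ¬ Covers X Y
      ¬coversY = proj₂ (lookupAny tightYs p)
      smaller : suc (length (Ys Any.─ p)) ≤ N
      smaller = subst (_≤ N) (length-removeAt′ Ys (Any.index p)) size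
      regroup : ∀ y → ((X ∩ Y) ∩ ⋂ (Ys Any.─ p)) y ≡ (X ∩ ⋂ Ys) y
      regroup y = trans (∧-assoc (X y) (Y y) (⋂ (Ys Any.─ p) y)) (cong (X y ∧_) (sym (⋂-─ p y)))

  ⋂-good : ∀ (Xs : List (Fin n → Bool)) → All Tight Xs → Good (⋂ Xs)
  ⋂-good Xs = ⋂-good′ (length Xs) Xs ≤-refl

module TightSets {n m : ℕ} (k : ℕ) (ends : Fin m → Fin n × Fin n) (o o′ : Fin m → Bool)
  (D-connected : KConnected k (orient ends o)) (D′-connected : KConnected k (orient ends o′))
  (v : Fin n) (surplus : outDeg (orient ends o′) v < outDeg (orient ends o) v) where

  open Reorientation ends o o′

  -- X contains v, misses some vertex, and (by k-connectivity) exactly k arcs of D leave it.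
  Tight : (Fin n → Bool) → Set
  Tight X = X v ≡ true × (∃ λ y → X y ≡ false) × outDegSet D X ≤ k

  tight⇒good : ∀ X → Tight X → Good X
  tight⇒good X (Xv , outside , δX≤k) = good {X} (≤-trans δX≤k (D′-connected X (v , Xv) outside))

  tight-meet : ∀ X Y → Tight X → Tight Y → (∃ λ y → (X ∪ Y) y ≡ false) → Tight (X ∩ Y)
  tight-meet X Y (Xv , (y , Xy) , δX≤k) (Yv , _ , δY≤k) outside =
    cong₂ _∧_ Xv Yv , (y , cong (_∧ Y y) Xy) , +-cancelʳ-≤ k (outDegSet D (X ∩ Y)) k (begin
      outDegSet D (X ∩ Y) + k                    ≤⟨ +-monoʳ-≤ (outDegSet D (X ∩ Y)) (D-connected (X ∪ Y) (v , cong (_∨ Y v) Xv) outside) ⟩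
      outDegSet D (X ∩ Y) + outDegSet D (X ∪ Y)  ≤⟨ outDegSet-submodular D X Y ⟩
      outDegSet D X + outDegSet D Y              ≤⟨ +-mono-≤ δX≤k δY≤k ⟩
      k + k                                      ∎)
    where open Data.Nat.Properties.≤-Reasoning

  Deficient : Fin n → Set
  Deficient u = outDeg D u < outDeg D′ u

  Conclusion : Set
  Conclusion = ∃ λ u → Deficient u × Flippable k D v u

  CutOff : List (Fin n) → Set
  CutOff us = Σ (List (Fin n → Bool)) λ Xs → All Tight Xs × (∀ {u} → u ∈ us → Deficient u → ⋂ Xs u ≡ false)

  separate : ∀ us → Conclusion ⊎ CutOff us
  separate [] = inj₂ ([] , [] , λ ())
  separate (u ∷ us) with separate us
  ... | inj₁ found = inj₁ found
  ... | inj₂ (Xs , tight , cut-off) with outDeg D u <? outDeg D′ u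
  ...   | no ¬deficient = inj₂ (Xs , tight , λ { (here refl) deficient → ⊥-elim (¬deficient deficient)
                                              ; (there u∈us) → cut-off u∈us })
  ...   | yes deficient with Menger.menger D v u (suc k)
  ...     | inj₁ paths = inj₁ (u , deficient , (λ { refl → <-asym surplus deficient }) , paths)
  ...     | inj₂ (X , Xv , Xu , δX<k+1) =
            inj₂ (X ∷ Xs , (Xv , (u , Xu) , ≤-pred δX<k+1) ∷ tight ,
                  λ { (here refl) _ → cong (_∧ ⋂ Xs u) Xu
                    ; {w} (there w∈us) deficient-w → trans (cong (X w ∧_) (cut-off w∈us deficient-w)) (∧-zeroʳ (X w)) })

  ⋂-contains-v : ∀ Xs → All Tight Xs → ⋂ Xs v ≡ true
  ⋂-contains-v [] [] = refl
  ⋂-contains-v (X ∷ Xs) ((Xv , _) ∷ tight) = cong₂ _∧_ Xv (⋂-contains-v Xs tight)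

  no-deficit : ∀ (I : Fin n → Bool) → (∀ {u} → u ∈ allFin n → Deficient u → I u ≡ false) →
               ∀ x → I x ≡ true → outDeg D′ x ≤ outDeg D x
  no-deficit I cut-off x x∈I = ≮⇒≥ λ deficient → false≢true (trans (sym (cut-off (∈-allFin x) deficient)) x∈I)
    where
    false≢true : false ≢ true
    false≢true ()

lemma7 : (n m k : ℕ) (ends : Fin m → Fin n × Fin n) → Loopless ends →
    (o o′ : Fin m → Bool) →
    KConnected k (orient ends o) → KConnected k (orient ends o′) →
    (v : Fin n) → outDeg (orient ends o′) v < outDeg (orient ends o) v →
    ∃ λ (u : Fin n) → outDeg (orient ends o) u < outDeg (orient ends o′) u
      × Flippable k (orient ends o) v u
lemma7 n m k ends _ o o′ D-connected D′-connected v surplus = [ id , impossible ] (separate (allFin n))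
  where
  open Reorientation ends o o′
  open TightSets k ends o o′ D-connected D′-connected v surplus
  open Uncrossing Tight Good good-ext good-everything tight⇒good tight-meet good-meet
  -- If every deficient vertex is cut off from v by a tight set, their
  -- intersection I is good by uncrossing, yet contains v and no deficient
  -- vertex, so summing over its vertices shows it is not good.
  impossible : CutOff (allFin n) → Conclusion
  impossible (Xs , tight , cut-off) =
    ⊥-elim (<⇒≱ (not-good (⋂-contains-v Xs tight) surplus (no-deficit (⋂ Xs) cut-off)) (⋂-good Xs tight))
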